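{- There is a universal constant $C\ge 2$ such that the following holds. Let $L,M\ge 1$ and $n\ge 1$. For every unsatisfiable CNF formula $F$ over $n$ variables and every $s_F\ge C\cdot(nLM+|F|)$ such that every resolution refutation of $F$ requires more than $s_F$ clauses, there is a decision-tree reduction of block-depth $O(n)$ from $\mathrm{rwPHP}(\mathrm{PLS})$ instances with parameters $L,M$ to $\textsc{Refuter}(s(F\vdash_{\mathsf{Res}}\bot)\le s_F)$.
   Context: Notation: $[N]=\{0,\dots,N-1\}$; $|F|$ is the number of clauses of $F$. Decision-tree reductions between search problems: an input $x$ of the source problem is mapped to an input of the target problem, each output block computed by a decision tree querying $x$, and each solution of the produced instance is mapped by a decision tree on $x$ to a valid solution of $x$; block-depth counts the number of distinct input blocks queried. $\mathrm{Iter}$ instance $(L,S)$: a function $S:[L]\to[L]$; a solution is $a\in[L]$ with ($a=0$ and $S(0)=0$) or $S(a)<a$ or ($S(a)>a$ and $S(S(a))=S(a)$). $\mathrm{rwPHP}(\mathrm{PLS})$ instance with parameters $L,M$: a function $f:[M]\to[2M]$; for each $y\in[2M]$ an $\mathrm{Iter}$ instance $I_y=(L,S_y)$ with $S_y:[L]\to[L]$; and for each $y$ a function $g_y:[L]\to[M]$. A solution is a pair $(y,a)$ with $y\in[2M]$, $a$ a solution of $I_y$, and $f(g_y(a))\ne y$. Resolution refutations of a CNF $F$ with variables $x_1,\dots,x_n$ and axioms $C_{ -m},\dots,C_{ -1}$: a sequence of nodes $C_0,\dots,C_{L'-1}$, each node containing a set of literals (the clause), a tag "resolution" (with integers $-m\le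 j,k<i$ and a variable index $a$) or "weakening" (with an integer $-m\le j<i$). Node $i$ is valid if for resolution $C_j=x_a\lor D$, $C_k=\overline{x}_a\lor E$, $C_i=D\lor E$ for some clauses $D,E$; for weakening $C_i=C_j\lor D$ for some clause $D$; and $C_{L'-1}=\bot$ (empty clause). Each node is a block. $\textsc{Refuter}(s(F\vdash_{\mathsf{Res}}\bot)\le s)$: the input is a purported resolution refutation of $F$ with at most $s$ nodes; a solution is an index of a node violating the validity conditions. -}

module Defs where

open import Data.Nat using (ℕ; zero; suc; _+_; _*_; _∸_; _≤_)
open import Data.Fin using (Fin; toℕ) renaming (_<_ to _<F_; _≟_ to _≟F_)
open import Data.Bool using (Bool; true; false; _∨_)
open import Data.Vec using (Vec; lookup; zipWith; replicate; tabulate)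
open import Data.List using (List; []; _∷_; length; deduplicate)
open import Data.Product using (Σ; ∃; ∃-syntax; _×_; _,_; proj₁; proj₂)
open import Data.Sum using (_⊎_; inj₁; inj₂)
open import Data.Unit using (⊤)
open import Relation.Nullary using (¬_; yes; no)
open import Relation.Nullary.Decidable using (isYes)
open import Relation.Binary.PropositionalEquality using (_≡_; _≢_; refl)
open import Relation.Binary.Definitions using (DecidableEquality)

record SearchProblem : Set₁ where
  field
    Blk   : Set
    Ans   : Blk → Set
    _≟B_  : DecidableEquality Blk
    Sol   : Set
    IsSol : ((b : Blk) → Ans b) → Sol → Set

data DT (Blk : Set) (Ans : Blk → Set) (O : Set) : Set where
  leaf  : O → DT Blk Ans O
  query : (b : Blk) → (Ans b → DT Blk Ans O) → DT Blk Ans O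

module _ {Blk : Set} {Ans : Blk → Set} {O : Set} where
  eval : DT Blk Ans O → ((b : Blk) → Ans b) → O
  eval (leaf o)    x = o
  eval (query b k) x = eval (k (x b)) x

  queried : DT Blk Ans O → ((b : Blk) → Ans b) → List Blk
  queried (leaf o)    x = []
  queried (query b k) x = b ∷ queried (k (x b)) x

  blockDepthOn : DecidableEquality Blk → DT Blk Ans O → ((b : Blk) → Ans b) → ℕ
  blockDepthOn _≟_ t x = length (deduplicate _≟_ (queried t x))

record DTReduction (P Q : SearchProblem) (d : ℕ) : Set where
  private
    module P = SearchProblem P
    module Q = SearchProblem Q
  field
    out  : (b : Q.Blk) → DT P.Blk P.Ans (Q.Ans b)
    back : Q.Sol → DT P.Blk P.Ans P.Sol
  instanceOf : ((b : P.Blk) → P.Ans b) → (b : Q.Blk) → Q.Ans b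
  instanceOf x b = eval (out b) x
  field
    correct   : ∀ x o → Q.IsSol (instanceOf x) o → P.IsSol x (eval (back o) x)
    outDepth  : ∀ x b → blockDepthOn P._≟B_ (out b) x ≤ d
    backDepth : ∀ x o → blockDepthOn P._≟B_ (back o) x ≤ d

IterSol : {L : ℕ} → (Fin L → Fin L) → Fin L → Set
IterSol S a =
  (toℕ a ≡ 0 × toℕ (S a) ≡ 0)
  ⊎ (S a <F a)
  ⊎ (a <F S a × S (S a) ≡ S a)

data RBlk (L M : ℕ) : Set where
  fB : Fin M → RBlk L M
  sB : Fin (2 * M) → Fin L → RBlk L M
  gB : Fin (2 * M) → Fin L → RBlk L M

RAns : {L M : ℕ} → RBlk L M → Set
RAns {L} {M} (fB _)   = Fin (2 * M)
RAns {L} {M} (sB _ _) = Fin L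
RAns {L} {M} (gB _ _) = Fin M

_≟R_ : {L M : ℕ} → DecidableEquality (RBlk L M)
fB i ≟R fB i' with i ≟F i'
... | yes refl = yes refl
... | no ne = no λ { refl → ne refl }
fB _ ≟R sB _ _ = no λ ()
fB _ ≟R gB _ _ = no λ ()
sB _ _ ≟R fB _ = no λ ()
sB y a ≟R sB y' a' with y ≟F y' | a ≟F a'
... | yes refl | yes refl = yes refl
... | no ne | _ = no λ { refl → ne refl }
... | _ | no ne = no λ { refl → ne refl }
sB _ _ ≟R gB _ _ = no λ ()
gB _ _ ≟R fB _ = no λ ()
gB _ _ ≟R sB _ _ = no λ ()
gB y a ≟R gB y' a' with y ≟F y' | a ≟F a'
... | yes refl | yes refl = yes refl
... | no ne | _ = no λ { refl → ne refl }
... | _ | no ne = no λ { refl → ne refl }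

RInput : ℕ → ℕ → Set
RInput L M = (b : RBlk L M) → RAns b

rwSol : {L M : ℕ} → RInput L M → Fin (2 * M) × Fin L → Set
rwSol x (y , a) =
  IterSol (λ b → x (sB y b)) a × x (fB (x (gB y a))) ≢ y

rwPHPPLS : ℕ → ℕ → SearchProblem
rwPHPPLS L M = record
  { Blk = RBlk L M ; Ans = RAns ; _≟B_ = _≟R_
  ; Sol = Fin (2 * M) × Fin L ; IsSol = rwSol }

-- a clause over n variables = a set of literals, given by its set of
-- positive and its set of negative variables
Clause : ℕ → Set
Clause n = Vec Bool n × Vec Bool n

_∪_ : {n : ℕ} → Clause n → Clause n → Clause n
(p , q) ∪ (p' , q') = zipWith _∨_ p p' , zipWith _∨_ q q'

emptyClause : {n : ℕ} → Clause n
emptyClause {n} = replicate n false , replicate n false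

posLit negLit : {n : ℕ} → Fin n → Clause n
posLit {n} a = tabulate (λ v → isYes (v ≟F a)) , replicate n false
negLit {n} a = replicate n false , tabulate (λ v → isYes (v ≟F a))

CNF : ℕ → ℕ → Set
CNF n m = Vec (Clause n) m

SatClause : {n : ℕ} → (Fin n → Bool) → Clause n → Set
SatClause α (p , q) =
  ∃[ v ] ((lookup p v ≡ true × α v ≡ true) ⊎ (lookup q v ≡ true × α v ≡ false))

Unsatisfiable : {n m : ℕ} → CNF n m → Set
Unsatisfiable {n} F = ∀ (α : Fin n → Bool) → ∃[ ℓ ] ¬ SatClause α (lookup F ℓ)

-- reference to an earlier clause: an axiom C_{-m+ℓ} (inj₁ ℓ) or node j (inj₂ j)
Ref : ℕ → ℕ → Set
Ref m s = Fin m ⊎ Fin s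

data Tag (n m s : ℕ) : Set where
  resolution : Ref m s → Ref m s → Fin n → Tag n m s
  weakening  : Ref m s → Tag n m s

Node : ℕ → ℕ → ℕ → Set
Node n m s = Clause n × Tag n m s

module _ {n m s : ℕ} (F : CNF n m) (P : Fin s → Node n m s) where
  clauseAt : Ref m s → Clause n
  clauseAt (inj₁ ℓ) = lookup F ℓ
  clauseAt (inj₂ j) = proj₁ (P j)

  RefBefore : Fin s → Ref m s → Set
  RefBefore i (inj₁ _) = ⊤
  RefBefore i (inj₂ j) = j <F i

  DerivOK : Fin s → Tag n m s → Set
  DerivOK i (resolution j k a) =
    RefBefore i j × RefBefore i k ×
    ∃[ D ] ∃[ E ] (clauseAt j ≡ posLit a ∪ D × clauseAt k ≡ negLit a ∪ E
                   × proj₁ (P i) ≡ D ∪ E)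
  DerivOK i (weakening j) =
    RefBefore i j × ∃[ D ] (proj₁ (P i) ≡ clauseAt j ∪ D)

  NodeValid : Fin s → Set
  NodeValid i = DerivOK i (proj₂ (P i)) × (toℕ i ≡ s ∸ 1 → proj₁ (P i) ≡ emptyClause)

IsRefutation : {n m s : ℕ} → CNF n m → (Fin s → Node n m s) → Set
IsRefutation {s = s} F P = 1 ≤ s × (∀ i → NodeValid F P i)

RequiresMoreThan : {n m : ℕ} → CNF n m → ℕ → Set
RequiresMoreThan {n} {m} F sF =
  ∀ s → s ≤ sF → (P : Fin s → Node n m s) → ¬ IsRefutation F P

Refuter : {n m : ℕ} → CNF n m → ℕ → SearchProblem
Refuter {n} {m} F sF = record
  { Blk = Fin sF ; Ans = λ _ → Node n m sF ; _≟B_ = _≟F_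
  ; Sol = Fin sF ; IsSol = λ P i → ¬ NodeValid F P i }

{-# OPTIONS --safe #-}
module Submission where

-- Read f : [M] → [2M] as sending pigeon i to a pair f(i) = (j, b) ∈ [M] × Bool.  Unfolding f
-- d times, pigeon i names an assignment β_d(i) to the first d variables: β_{d+1}(i) extends
-- β_d(j) by x_d := b.  The purported refutation has, for every layer d = n, …, 0 and every
-- pigeon i, a node holding the clause C_d(i) falsified by β_d(i).  At d = n it weakens an axiom
-- falsified by the total assignment β_n(i); below, it resolves on x_d the clauses of the holes
-- (i, false) and (i, true) one layer up.  The clause of a hole y = (j, b), namely the one
-- falsified by β_d(j) extended by x_d := b, is stored in L copies a ∈ [L], chained along the
-- Iter instance I_y: copy a weakens copy S_y(a) when a < S_y(a), and at an Iter solution a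
-- it weakens the pigeon node of g_y(a) one layer up, which is sound exactly when
-- f(g_y(a)) = y.  Copy 0 always starts such a chain, and the final node weakens the empty
-- clause C_0.  So the only invalid nodes are copies a of holes y with a a solution of I_y
-- and f(g_y(a)) ≠ y, i.e. solutions of rwPHP(PLS); every node is computed with at most
-- n + 3 queries.

open import Defs
open import Data.Bool using (Bool; true; false; not; _∧_; _∨_; if_then_else_)
open import Data.Bool.Properties using (∨-identityʳ; ∨-idem; ∧-identityʳ; ∧-zeroʳ; ¬-not)
open import Data.Empty using (⊥-elim)
open import Data.Fin
  using (Fin; toℕ; fromℕ; fromℕ<; inject₁; inject≤; opposite; combine; remQuot; splitAt; join; _↑ˡ_; _↑ʳ_)
  renaming (zero to fzero; suc to fsuc)
open import Data.Fin.Properties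
  using (toℕ-injective; toℕ<n; toℕ-fromℕ; toℕ-fromℕ<; toℕ-inject₁; toℕ-inject≤; toℕ-↑ˡ; toℕ-↑ʳ;
         toℕ-combine; combine-monoˡ-<; remQuot-combine; combine-remQuot; splitAt-↑ˡ; splitAt-↑ʳ;
         join-splitAt; opposite-prop; opposite-involutive; 2↔Bool)
  renaming (_≟_ to _≟F_; <-cmp to <-cmpF)
open import Data.List using (length)
open import Data.List.Properties using (length-deduplicate)
open import Data.Nat using (ℕ; zero; suc; _+_; _*_; _∸_; _≤_; _<_; z≤n; s≤s; _<ᵇ_; _≡ᵇ_; _≟_; _<?_)
open import Data.Nat.Properties
open import Data.Nat.Tactic.RingSolver using (solve-∀)
open import Data.Product using (∃-syntax; _×_; _,_; proj₁; proj₂)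
open import Data.Sum using (_⊎_; inj₁; inj₂; [_,_]′)
open import Data.Unit using (tt)
open import Data.Vec using (Vec; lookup; tabulate)
open import Data.Vec.Properties
  using (lookup∘tabulate; tabulate∘lookup; tabulate-cong; lookup-zipWith; lookup-replicate;
         zipWith-identityʳ; zipWith-idem)
open import Function using (Inverse; _∘_; _$_)
open import Relation.Binary.Definitions using (tri<; tri≈; tri>)
open import Relation.Binary.PropositionalEquality
open import Relation.Nullary using (¬_; Dec; yes; no)
open import Relation.Nullary.Decidable using (isYes; _×-dec_; _⊎-dec_)

module _ {B : Set} {A : B → Set} where

  infixr 4 _<$>_
  _<$>_ : {X Y : Set} → (X → Y) → DT B A X → DT B A Y
  f <$> leaf o    = leaf (f o)
  f <$> query b k = query b (λ a → f <$> k a)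

  eval-<$> : {X Y : Set} (f : X → Y) (t : DT B A X) (x : (b : B) → A b) →
             eval (f <$> t) x ≡ f (eval t x)
  eval-<$> f (leaf o)    x = refl
  eval-<$> f (query b k) x = eval-<$> f (k (x b)) x

  length-queried-<$> : {X Y : Set} (f : X → Y) (t : DT B A X) (x : (b : B) → A b) →
                       length (queried (f <$> t) x) ≡ length (queried t x)
  length-queried-<$> f (leaf o)    x = refl
  length-queried-<$> f (query b k) x = cong suc (length-queried-<$> f (k (x b)) x)

DTReduction-mono : ∀ {P Q d d'} → d ≤ d' → DTReduction P Q d → DTReduction P Q d'
DTReduction-mono d≤d' R = record
  { out       = out
  ; back      = back
  ; correct   = correct
  ; outDepth  = λ x b → ≤-trans (outDepth x b) d≤d'
  ; backDepth = λ x o → ≤-trans (backDepth x o) d≤d'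
  }
  where open DTReduction R

-- Clauses falsified by partial assignments

module _ {n : ℕ} where

  pos neg : Clause n → Fin n → Bool
  pos c = lookup (proj₁ c)
  neg c = lookup (proj₂ c)

  clause-ext : {c c' : Clause n} → (∀ v → pos c v ≡ pos c' v) → (∀ v → neg c v ≡ neg c' v) → c ≡ c'
  clause-ext {p , q} {p' , q'} hp hq = cong₂ _,_ (lookup-ext hp) (lookup-ext hq)
    where
    lookup-ext : {u w : Vec Bool n} → (∀ v → lookup u v ≡ lookup w v) → u ≡ w
    lookup-ext {u} {w} h = trans (sym (tabulate∘lookup u)) (trans (tabulate-cong h) (tabulate∘lookup w))

  pos-∪ : (c c' : Clause n) (v : Fin n) → pos (c ∪ c') v ≡ pos c v ∨ pos c' v
  pos-∪ (p , _) (p' , _) v = lookup-zipWith _∨_ v p p'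

  neg-∪ : (c c' : Clause n) (v : Fin n) → neg (c ∪ c') v ≡ neg c v ∨ neg c' v
  neg-∪ (_ , q) (_ , q') v = lookup-zipWith _∨_ v q q'

  ∪-identityʳ : (c : Clause n) → c ∪ emptyClause ≡ c
  ∪-identityʳ (p , q) =
    cong₂ _,_ (zipWith-identityʳ ∨-identityʳ p) (zipWith-identityʳ ∨-identityʳ q)

  ∪-idem : (c : Clause n) → c ∪ c ≡ c
  ∪-idem (p , q) = cong₂ _,_ (zipWith-idem ∨-idem p) (zipWith-idem ∨-idem q)

  falsifiedBy : ℕ → (Fin n → Bool) → Clause n
  falsifiedBy d β = tabulate (λ v → (toℕ v <ᵇ d) ∧ not (β v))
                  , tabulate (λ v → (toℕ v <ᵇ d) ∧ β v)

  pos-falsifiedBy : ∀ d β v → pos (falsifiedBy d β) v ≡ (toℕ v <ᵇ d) ∧ not (β v)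
  pos-falsifiedBy d β = lookup∘tabulate (λ v → (toℕ v <ᵇ d) ∧ not (β v))

  neg-falsifiedBy : ∀ d β v → neg (falsifiedBy d β) v ≡ (toℕ v <ᵇ d) ∧ β v
  neg-falsifiedBy d β = lookup∘tabulate (λ v → (toℕ v <ᵇ d) ∧ β v)

  _[_≔_] : (Fin n → Bool) → ℕ → Bool → Fin n → Bool
  (β [ d ≔ b ]) v = if toℕ v ≡ᵇ d then b else β v

  falsifiedLiteral : Fin n → Bool → Clause n
  falsifiedLiteral w false = posLit w
  falsifiedLiteral w true  = negLit w

  falsifiedBy-zero : (β : Fin n → Bool) → falsifiedBy 0 β ≡ emptyClause
  falsifiedBy-zero β = clause-ext (λ v → trans (pos-falsifiedBy 0 β v) (sym (lookup-replicate v false)))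
                                  (λ v → trans (neg-falsifiedBy 0 β v) (sym (lookup-replicate v false)))

  private
    <ᵇ-suc-if : ∀ m d (φ : Bool → Bool) b x →
                (m <ᵇ suc d) ∧ φ (if m ≡ᵇ d then b else x) ≡ (m ≡ᵇ d) ∧ φ b ∨ (m <ᵇ d) ∧ φ x
    <ᵇ-suc-if zero    zero    φ b x = sym (∨-identityʳ (φ b))
    <ᵇ-suc-if zero    (suc d) φ b x = refl
    <ᵇ-suc-if (suc m) zero    φ b x = refl
    <ᵇ-suc-if (suc m) (suc d)       = <ᵇ-suc-if m d

    isYes-≟ : ∀ {k} (v w : Fin k) → isYes (v ≟F w) ≡ (toℕ v ≡ᵇ toℕ w)
    isYes-≟ fzero    fzero    = refl
    isYes-≟ fzero    (fsuc w) = refl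
    isYes-≟ (fsuc v) fzero    = refl
    isYes-≟ (fsuc v) (fsuc w) with v ≟F w | isYes-≟ v w
    ... | yes _ | ih = ih
    ... | no _  | ih = ih

    pos-falsifiedLiteral : ∀ w b v → pos (falsifiedLiteral w b) v ≡ (toℕ v ≡ᵇ toℕ w) ∧ not b
    pos-falsifiedLiteral w false v =
      trans (lookup∘tabulate _ v) (trans (isYes-≟ v w) (sym (∧-identityʳ _)))
    pos-falsifiedLiteral w true  v = trans (lookup-replicate v false) (sym (∧-zeroʳ _))

    neg-falsifiedLiteral : ∀ w b v → neg (falsifiedLiteral w b) v ≡ (toℕ v ≡ᵇ toℕ w) ∧ b
    neg-falsifiedLiteral w false v = trans (lookup-replicate v false) (sym (∧-zeroʳ _))
    neg-falsifiedLiteral w true  v =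
      trans (lookup∘tabulate _ v) (trans (isYes-≟ v w) (sym (∧-identityʳ _)))

  falsifiedBy-update : ∀ {d} β w b → toℕ w ≡ d →
                       falsifiedBy (suc d) (β [ d ≔ b ]) ≡ falsifiedLiteral w b ∪ falsifiedBy d β
  falsifiedBy-update β w b refl = clause-ext on-pos on-neg
    where
    open ≡-Reasoning
    d = toℕ w

    on-pos : ∀ v → pos (falsifiedBy (suc d) (β [ d ≔ b ])) v ≡ pos (falsifiedLiteral w b ∪ falsifiedBy d β) v
    on-pos v = begin
      pos (falsifiedBy (suc d) (β [ d ≔ b ])) v
        ≡⟨ pos-falsifiedBy (suc d) (β [ d ≔ b ]) v ⟩
      (toℕ v <ᵇ suc d) ∧ not ((β [ d ≔ b ]) v)
        ≡⟨ <ᵇ-suc-if (toℕ v) d not b (β v) ⟩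
      (toℕ v ≡ᵇ d) ∧ not b ∨ (toℕ v <ᵇ d) ∧ not (β v)
        ≡⟨ cong₂ _∨_ (pos-falsifiedLiteral w b v) (pos-falsifiedBy d β v) ⟨
      pos (falsifiedLiteral w b) v ∨ pos (falsifiedBy d β) v
        ≡⟨ pos-∪ (falsifiedLiteral w b) (falsifiedBy d β) v ⟨
      pos (falsifiedLiteral w b ∪ falsifiedBy d β) v
        ∎

    on-neg : ∀ v → neg (falsifiedBy (suc d) (β [ d ≔ b ])) v ≡ neg (falsifiedLiteral w b ∪ falsifiedBy d β) v
    on-neg v = begin
      neg (falsifiedBy (suc d) (β [ d ≔ b ])) v
        ≡⟨ neg-falsifiedBy (suc d) (β [ d ≔ b ]) v ⟩
      (toℕ v <ᵇ suc d) ∧ (β [ d ≔ b ]) v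
        ≡⟨ <ᵇ-suc-if (toℕ v) d (λ c → c) b (β v) ⟩
      (toℕ v ≡ᵇ d) ∧ b ∨ (toℕ v <ᵇ d) ∧ β v
        ≡⟨ cong₂ _∨_ (neg-falsifiedLiteral w b v) (neg-falsifiedBy d β v) ⟨
      neg (falsifiedLiteral w b) v ∨ neg (falsifiedBy d β) v
        ≡⟨ neg-∪ (falsifiedLiteral w b) (falsifiedBy d β) v ⟨
      neg (falsifiedLiteral w b ∪ falsifiedBy d β) v
        ∎

  private
    toℕ<ᵇn : ∀ {k} (v : Fin k) → (toℕ v <ᵇ k) ≡ true
    toℕ<ᵇn fzero    = refl
    toℕ<ᵇn (fsuc v) = toℕ<ᵇn v

    ∨-absorbs : ∀ {a b} → (a ≡ true → b ≡ true) → a ∨ b ≡ b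
    ∨-absorbs {false} h = refl
    ∨-absorbs {true}  h = sym (h refl)

  -- β falsifies every literal of C, and falsifiedBy n β collects all literals β falsifies.
  ∪-falsifiedBy : ∀ {β} (C : Clause n) → ¬ SatClause β C → C ∪ falsifiedBy n β ≡ falsifiedBy n β
  ∪-falsifiedBy {β} C unsatC = clause-ext
    (λ v → trans (pos-∪ C (falsifiedBy n β) v) (∨-absorbs λ p → trans (pos-falsifiedBy n β v)
             (cong₂ _∧_ (toℕ<ᵇn v) (cong not (¬-not λ e → unsatC (v , inj₁ (p , e)))))))
    (λ v → trans (neg-∪ C (falsifiedBy n β) v) (∨-absorbs λ q → trans (neg-falsifiedBy n β v)
             (cong₂ _∧_ (toℕ<ᵇn v) (¬-not λ e → unsatC (v , inj₂ (q , e))))))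

module Derivation {n m s : ℕ} (F : CNF n m) (P : Fin s → Node n m s) where

  weakening-ok : ∀ {i c j} D → P i ≡ (c , weakening j) → RefBefore F P i j →
                 c ≡ clauseAt F P j ∪ D → DerivOK F P i (proj₂ (P i))
  weakening-ok {i} D eq j<i c≡ =
    subst (DerivOK F P i) (sym (cong proj₂ eq)) (j<i , D , trans (cong proj₁ eq) c≡)

  resolution-ok : ∀ {i c j k a} → P i ≡ (c , resolution j k a) →
                  RefBefore F P i j → RefBefore F P i k →
                  clauseAt F P j ≡ posLit a ∪ c → clauseAt F P k ≡ negLit a ∪ c →
                  DerivOK F P i (proj₂ (P i))
  resolution-ok {i} {c} eq j<i k<i cj ck = subst (DerivOK F P i) (sym (cong proj₂ eq))
    (j<i , k<i , c , c , cj , ck , trans (cong proj₁ eq) (sym (∪-idem c)))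

-- Iter

module _ {L : ℕ} where

  -- IterSol S a unfolds to IterSolAt a (S a) (S (S a)); a decision tree only sees these two values.
  IterSolAt : Fin L → Fin L → Fin L → Set
  IterSolAt a s ss = (toℕ a ≡ 0 × toℕ s ≡ 0) ⊎ (toℕ s < toℕ a) ⊎ (toℕ a < toℕ s × ss ≡ s)

  iterSolAt? : (a s ss : Fin L) → Dec (IterSolAt a s ss)
  iterSolAt? a s ss = ((toℕ a ≟ 0) ×-dec (toℕ s ≟ 0))
                      ⊎-dec ((toℕ s <? toℕ a) ⊎-dec ((toℕ a <? toℕ s) ×-dec (ss ≟F s)))

  SolvedOrAdvancing : (Fin L → Fin L) → Fin L → Set
  SolvedOrAdvancing S a = IterSol S a ⊎ toℕ a < toℕ (S a)

  successor-solvedOrAdvancing : ∀ S a → ¬ IterSol S a → toℕ a < toℕ (S a) → SolvedOrAdvancing S (S a)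
  successor-solvedOrAdvancing S a ¬sol a<Sa with <-cmpF (S a) (S (S a))
  ... | tri< Sa<SSa _ _ = inj₂ Sa<SSa
  ... | tri≈ _ Sa≡SSa _ = ⊥-elim (¬sol (inj₂ (inj₂ (a<Sa , sym Sa≡SSa))))
  ... | tri> _ _ SSa<Sa = inj₁ (inj₂ (inj₁ SSa<Sa))

zero-solvedOrAdvancing : ∀ {L} (S : Fin (suc L) → Fin (suc L)) → SolvedOrAdvancing S fzero
zero-solvedOrAdvancing S with toℕ (S fzero) ≟ 0
... | yes S0≡0 = inj₁ (inj₁ (refl , S0≡0))
... | no  S0≢0 = inj₂ (n≢0⇒n>0 S0≢0)

-- The reduction

combine-monoʳ-< : ∀ {m k} (r : Fin m) {q q' : Fin k} → toℕ q < toℕ q' →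
                  toℕ (combine r q) < toℕ (combine r q')
combine-monoʳ-< {k = k} r {q} {q'} q<q' =
  subst₂ _<_ (sym (toℕ-combine r q)) (sym (toℕ-combine r q')) (+-monoʳ-< (k * toℕ r) q<q')

opposite-<-reverse : ∀ {k} {a s : Fin k} → toℕ a < toℕ s → toℕ (opposite s) < toℕ (opposite a)
opposite-<-reverse {a = a} {s} a<s =
  subst₂ _<_ (sym (opposite-prop s)) (sym (opposite-prop a)) (∸-monoʳ-< (s≤s a<s) (toℕ<n s))

nodeCount : ℕ → ℕ → ℕ → ℕ
nodeCount L M n = suc n * (2 * M * L + M)

module Construction (L' M' n : ℕ) {m : ℕ} (F : CNF n m) (unsat : Unsatisfiable F)
                    (sF : ℕ) (room : nodeCount (suc L') (suc M') n < sF) where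

  L M B T : ℕ
  L = suc L'
  M = suc M'
  B = 2 * M * L + M
  T = nodeCount L M n

  Tree : Set → Set
  Tree = DT (RBlk L M) RAns

  pair : Fin M → Bool → Fin (2 * M)
  pair i b = combine (Inverse.from 2↔Bool b) i

  unpair : Fin (2 * M) → Fin M × Bool
  unpair y = proj₂ (remQuot {2} M y) , Inverse.to 2↔Bool (proj₁ (remQuot {2} M y))

  unpair-pair : ∀ i b → unpair (pair i b) ≡ (i , b)
  unpair-pair i b = trans
    (cong (λ p → proj₂ p , Inverse.to 2↔Bool (proj₁ p)) (remQuot-combine (Inverse.from 2↔Bool b) i))
    (cong (i ,_) (Inverse.strictlyInverseˡ 2↔Bool b))

  assignment : ℕ → Fin M → Tree (Fin n → Bool)
  holeAssignment : ℕ → Fin (2 * M) → Tree (Fin n → Bool)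
  assignment zero    i = leaf (λ _ → false)
  assignment (suc d) i = query (fB i) (holeAssignment d)
  holeAssignment d y = _[ d ≔ proj₂ (unpair y) ] <$> assignment d (proj₁ (unpair y))

  data Slot : Set where
    holeSlot   : Fin (suc n) → Fin (2 * M) → Fin L → Slot
    pigeonSlot : Fin (suc n) → Fin M → Slot

  -- Block r lists the hole copies, with a in decreasing order so that weakening along S_y
  -- points backwards, followed by the pigeon nodes of layer n ∸ r.
  encode : Slot → Fin T
  encode (holeSlot r y a)  = combine r (combine y (opposite a) ↑ˡ M)
  encode (pigeonSlot r i) = combine r (2 * M * L ↑ʳ i)

  slotIn : Fin (suc n) → Fin (2 * M * L) ⊎ Fin M → Slot
  slotIn r (inj₁ c) = holeSlot r (proj₁ (remQuot {2 * M} L c)) (opposite (proj₂ (remQuot {2 * M} L c)))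
  slotIn r (inj₂ i) = pigeonSlot r i

  decode : Fin T → Slot
  decode t = slotIn (proj₁ (remQuot {suc n} B t)) (splitAt (2 * M * L) (proj₂ (remQuot {suc n} B t)))

  decode-combine : ∀ r q → decode (combine r q) ≡ slotIn r (splitAt (2 * M * L) q)
  decode-combine r q = cong (λ p → slotIn (proj₁ p) (splitAt (2 * M * L) (proj₂ p))) (remQuot-combine r q)

  decode-encode : ∀ s → decode (encode s) ≡ s
  decode-encode (holeSlot r y a) = begin
    decode (encode (holeSlot r y a))                    ≡⟨ decode-combine r (combine y (opposite a) ↑ˡ M) ⟩
    slotIn r (splitAt _ (combine y (opposite a) ↑ˡ M))  ≡⟨ cong (slotIn r)
                                                                (splitAt-↑ˡ _ (combine y (opposite a)) M) ⟩
    slotIn r (inj₁ (combine y (opposite a)))            ≡⟨ cong (λ p → holeSlot r (proj₁ p) (opposite (proj₂ p)))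
                                                                (remQuot-combine y (opposite a)) ⟩
    holeSlot r y (opposite (opposite a))                ≡⟨ cong (holeSlot r y) (opposite-involutive a) ⟩
    holeSlot r y a                                      ∎
    where open ≡-Reasoning
  decode-encode (pigeonSlot r i) =
    trans (decode-combine r (2 * M * L ↑ʳ i)) (cong (slotIn r) (splitAt-↑ʳ (2 * M * L) M i))

  encode-slotIn : ∀ r e → encode (slotIn r e) ≡ combine r (join (2 * M * L) M e)
  encode-slotIn r (inj₁ c) = cong (λ q → combine r (q ↑ˡ M)) (trans
    (cong (combine (proj₁ (remQuot {2 * M} L c))) (opposite-involutive (proj₂ (remQuot {2 * M} L c))))
    (combine-remQuot {2 * M} L c))
  encode-slotIn r (inj₂ i) = refl

  encode-decode : ∀ t → encode (decode t) ≡ t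
  encode-decode t = begin
    encode (decode t)                                       ≡⟨ encode-slotIn r (splitAt (2 * M * L) q) ⟩
    combine r (join (2 * M * L) M (splitAt (2 * M * L) q))  ≡⟨ cong (combine r) (join-splitAt (2 * M * L) M q) ⟩
    combine r q                                             ≡⟨ combine-remQuot {suc n} B t ⟩
    t                                                       ∎
    where
    open ≡-Reasoning
    r = proj₁ (remQuot {suc n} B t)
    q = proj₂ (remQuot {suc n} B t)

  index : Slot → Fin sF
  index s = inject≤ (encode s) (<⇒≤ room)

  index-< : ∀ s s' → toℕ (encode s) < toℕ (encode s') → toℕ (index s) < toℕ (index s')
  index-< s s' = subst₂ _<_ (sym (toℕ-inject≤ (encode s) _)) (sym (toℕ-inject≤ (encode s') _))

  index<T : ∀ s → toℕ (index s) < T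
  index<T s = subst (_< T) (sym (toℕ-inject≤ (encode s) _)) (toℕ<n (encode s))

  index-not-last : ∀ s → toℕ (index s) ≢ sF ∸ 1
  index-not-last s last = <-irrefl last (<-≤-trans (index<T s) (<⇒≤pred room))

  hole-before-hole : ∀ r y {a s} → toℕ a < toℕ s →
                     toℕ (index (holeSlot r y s)) < toℕ (index (holeSlot r y a))
  hole-before-hole r y {a} {s} a<s = index-< (holeSlot r y s) (holeSlot r y a) $ combine-monoʳ-< r $
    subst₂ _<_ (sym (toℕ-↑ˡ (combine y (opposite s)) M)) (sym (toℕ-↑ˡ (combine y (opposite a)) M))
      (combine-monoʳ-< y (opposite-<-reverse a<s))

  hole-before-pigeon : ∀ r y a i → toℕ (index (holeSlot r y a)) < toℕ (index (pigeonSlot r i))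
  hole-before-pigeon r y a i = index-< (holeSlot r y a) (pigeonSlot r i) $ combine-monoʳ-< r $
    subst₂ _<_ (sym (toℕ-↑ˡ (combine y (opposite a)) M)) (sym (toℕ-↑ʳ (2 * M * L) i))
      (<-≤-trans (toℕ<n (combine y (opposite a))) (m≤m+n _ _))

  pigeon-before-next-hole : ∀ r' g y a →
    toℕ (index (pigeonSlot (inject₁ r') g)) < toℕ (index (holeSlot (fsuc r') y a))
  pigeon-before-next-hole r' g y a = index-< (pigeonSlot (inject₁ r') g) (holeSlot (fsuc r') y a) $
    combine-monoˡ-< _ _ (s≤s (≤-reflexive (toℕ-inject₁ r')))

  -- Every position from T on holds the final node, so in particular the last one does.
  data Kind : Set where
    slot : Slot → Kind
    tail : Kind

  kind : Fin sF → Kind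
  kind o with toℕ o <? T
  ... | yes o<T = slot (decode (fromℕ< o<T))
  ... | no  _   = tail

  kind-index : ∀ s → kind (index s) ≡ slot s
  kind-index s with toℕ (index s) <? T
  ... | yes i<T = cong slot $ trans
          (cong decode (toℕ-injective (trans (toℕ-fromℕ< i<T) (toℕ-inject≤ (encode s) _))))
          (decode-encode s)
  ... | no  i≮T = ⊥-elim (i≮T (index<T s))

  kind-tail : ∀ {o} → T ≤ toℕ o → kind o ≡ tail
  kind-tail {o} T≤o with toℕ o <? T
  ... | yes o<T = ⊥-elim (<⇒≱ o<T T≤o)
  ... | no  _   = refl

  data Location : Fin sF → Set where
    at     : ∀ s → Location (index s)
    inTail : ∀ {o} → T ≤ toℕ o → Location o

  locate : ∀ o → Location o
  locate o with toℕ o <? T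
  ... | yes o<T = subst Location (toℕ-injective index≡o) (at (decode (fromℕ< o<T)))
    where
    index≡o : toℕ (index (decode (fromℕ< o<T))) ≡ toℕ o
    index≡o = trans (toℕ-inject≤ _ _) (trans (cong toℕ (encode-decode _)) (toℕ-fromℕ< o<T))
  ... | no  o≮T = inTail (≮⇒≥ o≮T)

  layer : Fin (suc n) → ℕ
  layer r = n ∸ toℕ r

  layer-fromℕ : layer (fromℕ n) ≡ 0
  layer-fromℕ = trans (cong (n ∸_) (toℕ-fromℕ n)) (n∸n≡0 n)

  layer-inject₁ : ∀ r' → layer (inject₁ r') ≡ suc (layer (fsuc r'))
  layer-inject₁ r' = trans (cong (n ∸_) (toℕ-inject₁ r')) (+-∸-assoc 1 (toℕ<n r'))

  rootSlot : Slot
  rootSlot = pigeonSlot (fromℕ n) fzero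

  padding final : Node n m sF
  padding = lookup F ℓ₀ , weakening (inj₁ ℓ₀)
    where ℓ₀ = proj₁ (unsat (λ _ → false))
  final = emptyClause , weakening (inj₂ (index rootSlot))

  pigeonTag : Fin (suc n) → Fin M → (Fin n → Bool) → Tag n m sF
  pigeonTag fzero     i β = weakening (inj₁ (proj₁ (unsat β)))
  pigeonTag (fsuc r') i β = resolution (inj₂ (index (holeSlot (fsuc r') (pair i false) fzero)))
                                       (inj₂ (index (holeSlot (fsuc r') (pair i true) fzero)))
                                       (opposite r')

  pigeonTree : Fin (suc n) → Fin M → Tree (Node n m sF)
  pigeonTree r i = (λ β → falsifiedBy (layer r) β , pigeonTag r i β) <$> assignment (layer r) i

  holeNodeFrom : Fin n → Fin (2 * M) → Slot → Tree (Node n m sF)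
  holeNodeFrom r' y source =
    (λ β → falsifiedBy (suc (layer (fsuc r'))) β , weakening (inj₂ (index source)))
    <$> holeAssignment (layer (fsuc r')) y

  holeStep : ∀ {Sol Fwd : Set} → Fin n → Fin (2 * M) → (a s : Fin L) → Dec Sol → Dec Fwd →
             Tree (Node n m sF)
  holeStep r' y a s (yes _) _       = query (gB y a) λ g → holeNodeFrom r' y (pigeonSlot (inject₁ r') g)
  holeStep r' y a s (no _)  (yes _) = holeNodeFrom r' y (holeSlot (fsuc r') y s)
  holeStep r' y a s (no _)  (no _)  = leaf padding

  slotTree : Slot → Tree (Node n m sF)
  slotTree (holeSlot fzero     y a) = leaf padding
  slotTree (holeSlot (fsuc r') y a) =
    query (sB y a) λ s → query (sB y s) λ ss → holeStep r' y a s (iterSolAt? a s ss) (toℕ a <? toℕ s)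
  slotTree (pigeonSlot r i)         = pigeonTree r i

  kindTree : Kind → Tree (Node n m sF)
  kindTree (slot s) = slotTree s
  kindTree tail     = leaf final

  kindSolution : Kind → Fin (2 * M) × Fin L
  kindSolution (slot (holeSlot _ y a)) = y , a
  kindSolution _                       = fzero , fzero

  length-assignment : ∀ d i x → length (queried (assignment d i) x) ≡ d
  length-holeAssignment : ∀ d y x → length (queried (holeAssignment d y) x) ≡ d
  length-assignment zero    i x = refl
  length-assignment (suc d) i x = cong suc (length-holeAssignment d (x (fB i)) x)
  length-holeAssignment d y x = trans
    (length-queried-<$> _[ d ≔ proj₂ (unpair y) ] (assignment d (proj₁ (unpair y))) x)
    (length-assignment d (proj₁ (unpair y)) x)

  length-holeNodeFrom : ∀ r' y source x → length (queried (holeNodeFrom r' y source) x) ≤ n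
  length-holeNodeFrom r' y source x = begin
    length (queried (holeNodeFrom r' y source) x)  ≡⟨ length-queried-<$> _ (holeAssignment d y) x ⟩
    length (queried (holeAssignment d y) x)        ≡⟨ length-holeAssignment d y x ⟩
    n ∸ suc (toℕ r')                               ≤⟨ m∸n≤m n (suc (toℕ r')) ⟩
    n                                              ∎
    where
    open ≤-Reasoning
    d = layer (fsuc r')

  length-holeStep : ∀ {Sol Fwd : Set} r' y a s (sol? : Dec Sol) (fwd? : Dec Fwd) x →
                    length (queried (holeStep r' y a s sol? fwd?) x) ≤ suc n
  length-holeStep r' y a s (yes _) _       x =
    s≤s (length-holeNodeFrom r' y (pigeonSlot (inject₁ r') (x (gB y a))) x)
  length-holeStep r' y a s (no _)  (yes _) x =
    m≤n⇒m≤1+n (length-holeNodeFrom r' y (holeSlot (fsuc r') y s) x)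
  length-holeStep r' y a s (no _)  (no _)  x = z≤n

  length-kindTree : ∀ k x → length (queried (kindTree k) x) ≤ 3 + n
  length-kindTree tail                            x = z≤n
  length-kindTree (slot (holeSlot fzero y a))     x = z≤n
  length-kindTree (slot (holeSlot (fsuc r') y a)) x =
    s≤s (s≤s (length-holeStep r' y a s (iterSolAt? a s (x (sB y s))) (toℕ a <? toℕ s) x))
    where s = x (sB y a)
  length-kindTree (slot (pigeonSlot r i))         x = begin
    length (queried (pigeonTree r i) x)          ≡⟨ length-queried-<$> _ (assignment (layer r) i) x ⟩
    length (queried (assignment (layer r) i) x)  ≡⟨ length-assignment (layer r) i x ⟩
    n ∸ toℕ r                                    ≤⟨ m∸n≤m n (toℕ r) ⟩
    n                                            ≤⟨ m≤n+m n 3 ⟩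
    3 + n                                        ∎
    where open ≤-Reasoning

  module Valid (x : RInput L M) where

    P : Fin sF → Node n m sF
    P o = eval (kindTree (kind o)) x

    open Derivation F P

    S : Fin (2 * M) → Fin L → Fin L
    S y a = x (sB y a)

    β : ℕ → Fin M → Fin n → Bool
    β d i = eval (assignment d i) x

    βʸ : ℕ → Fin (2 * M) → Fin n → Bool
    βʸ d y = eval (holeAssignment d y) x

    holeClause : Fin n → Fin (2 * M) → Clause n
    holeClause r' y = falsifiedBy (suc (layer (fsuc r'))) (βʸ (layer (fsuc r')) y)

    βʸ-pair : ∀ d i b → βʸ d (pair i b) ≡ β d i [ d ≔ b ]
    βʸ-pair d i b = trans (eval-<$> _ (assignment d (proj₁ (unpair (pair i b)))) x)
                          (cong (λ p → β d (proj₁ p) [ d ≔ proj₂ p ]) (unpair-pair i b))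

    P-index : ∀ s → P (index s) ≡ eval (slotTree s) x
    P-index s = cong (λ k → eval (kindTree k) x) (kind-index s)

    P-tail : ∀ {o} → T ≤ toℕ o → P o ≡ final
    P-tail T≤o = cong (λ k → eval (kindTree k) x) (kind-tail T≤o)

    P-pigeon : ∀ r i → P (index (pigeonSlot r i))
                       ≡ (falsifiedBy (layer r) (β (layer r) i) , pigeonTag r i (β (layer r) i))
    P-pigeon r i = trans (P-index (pigeonSlot r i))
      (eval-<$> (λ β → falsifiedBy (layer r) β , pigeonTag r i β) (assignment (layer r) i) x)

    eval-holeNodeFrom : ∀ r' y source →
                        eval (holeNodeFrom r' y source) x ≡ (holeClause r' y , weakening (inj₂ (index source)))
    eval-holeNodeFrom r' y source =
      eval-<$> (λ β → falsifiedBy (suc (layer (fsuc r'))) β , weakening (inj₂ (index source)))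
               (holeAssignment (layer (fsuc r')) y) x

    pigeon-clause : ∀ r i → proj₁ (P (index (pigeonSlot r i))) ≡ falsifiedBy (layer r) (β (layer r) i)
    pigeon-clause r i = cong proj₁ (P-pigeon r i)

    next-pigeon-clause : ∀ r' g → proj₁ (P (index (pigeonSlot (inject₁ r') g))) ≡ holeClause r' (x (fB g))
    next-pigeon-clause r' g =
      trans (pigeon-clause (inject₁ r') g) (cong (λ l → falsifiedBy l (β l g)) (layer-inject₁ r'))

    hole-clause : ∀ r' y a → SolvedOrAdvancing (S y) a →
                  proj₁ (P (index (holeSlot (fsuc r') y a))) ≡ holeClause r' y
    hole-clause r' y a progress = trans (cong proj₁ (P-index (holeSlot (fsuc r') y a)))
      (by-step (iterSolAt? a (S y a) (S y (S y a))) (toℕ a <? toℕ (S y a)))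
      where
      by-step : (sol? : Dec (IterSol (S y) a)) (fwd? : Dec (toℕ a < toℕ (S y a))) →
                proj₁ (eval (holeStep r' y a (S y a) sol? fwd?) x) ≡ holeClause r' y
      by-step (yes _)   _         = cong proj₁ (eval-holeNodeFrom r' y (pigeonSlot (inject₁ r') (x (gB y a))))
      by-step (no _)    (yes _)   = cong proj₁ (eval-holeNodeFrom r' y (holeSlot (fsuc r') y (S y a)))
      by-step (no ¬sol) (no ¬fwd) = ⊥-elim ([ ¬sol , ¬fwd ]′ progress)

    resolvent : ∀ r' i b → proj₁ (P (index (holeSlot (fsuc r') (pair i b) fzero)))
                           ≡ falsifiedLiteral (opposite r') b
                             ∪ falsifiedBy (layer (fsuc r')) (β (layer (fsuc r')) i)
    resolvent r' i b = begin
      proj₁ (P (index (holeSlot (fsuc r') (pair i b) fzero)))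
        ≡⟨ hole-clause r' (pair i b) fzero (zero-solvedOrAdvancing (S (pair i b))) ⟩
      holeClause r' (pair i b)
        ≡⟨ cong (falsifiedBy (suc d)) (βʸ-pair d i b) ⟩
      falsifiedBy (suc d) (β d i [ d ≔ b ])
        ≡⟨ falsifiedBy-update (β d i) (opposite r') b (opposite-prop r') ⟩
      falsifiedLiteral (opposite r') b ∪ falsifiedBy d (β d i)
        ∎
      where
      open ≡-Reasoning
      d = layer (fsuc r')

    valid-index : ∀ s → DerivOK F P (index s) (proj₂ (P (index s))) → NodeValid F P (index s)
    valid-index s ok = ok , λ last → ⊥-elim (index-not-last s last)

    padding-ok : ∀ {o} → P o ≡ padding → DerivOK F P o (proj₂ (P o))
    padding-ok eq = weakening-ok emptyClause eq tt (sym (∪-identityʳ _))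

    hole-valid-from : ∀ r' y a source →
      P (index (holeSlot (fsuc r') y a)) ≡ eval (holeNodeFrom r' y source) x →
      toℕ (index source) < toℕ (index (holeSlot (fsuc r') y a)) →
      proj₁ (P (index source)) ≡ holeClause r' y →
      NodeValid F P (index (holeSlot (fsuc r') y a))
    hole-valid-from r' y a source eq source<here same-clause = valid-index (holeSlot (fsuc r') y a) $
      weakening-ok emptyClause (trans eq (eval-holeNodeFrom r' y source)) source<here
        (sym (trans (∪-identityʳ (proj₁ (P (index source)))) same-clause))

    pigeon-valid : ∀ r i → NodeValid F P (index (pigeonSlot r i))
    pigeon-valid fzero     i = valid-index (pigeonSlot fzero i) $
      weakening-ok (falsifiedBy n (β n i)) (P-pigeon fzero i) tt
        (sym (∪-falsifiedBy (lookup F (proj₁ (unsat (β n i)))) (proj₂ (unsat (β n i)))))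
    pigeon-valid (fsuc r') i = valid-index (pigeonSlot (fsuc r') i) $
      resolution-ok (P-pigeon (fsuc r') i)
        (hole-before-pigeon (fsuc r') (pair i false) fzero i) (hole-before-pigeon (fsuc r') (pair i true) fzero i)
        (resolvent r' i false) (resolvent r' i true)

    tail-valid : ∀ {o} → T ≤ toℕ o → NodeValid F P o
    tail-valid T≤o = weakening-ok emptyClause (P-tail T≤o) (<-≤-trans (index<T rootSlot) T≤o) root-empty
                   , λ _ → cong proj₁ (P-tail T≤o)
      where
      open ≡-Reasoning
      root-empty : emptyClause ≡ proj₁ (P (index rootSlot)) ∪ emptyClause
      root-empty = begin
        emptyClause                                                ≡⟨ falsifiedBy-zero (β 0 fzero) ⟨
        falsifiedBy 0 (β 0 fzero)                                  ≡⟨ cong (λ l → falsifiedBy l (β l fzero)) layer-fromℕ ⟨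
        falsifiedBy (layer (fromℕ n)) (β (layer (fromℕ n)) fzero)  ≡⟨ pigeon-clause (fromℕ n) fzero ⟨
        proj₁ (P (index rootSlot))                                 ≡⟨ ∪-identityʳ _ ⟨
        proj₁ (P (index rootSlot)) ∪ emptyClause                   ∎

    hole-solution : ∀ r' y a → ¬ NodeValid F P (index (holeSlot (fsuc r') y a)) → rwSol x (y , a)
    hole-solution r' y a invalid =
      by-step (iterSolAt? a (S y a) (S y (S y a))) (toℕ a <? toℕ (S y a)) (P-index (holeSlot (fsuc r') y a))
      where
      by-step : (sol? : Dec (IterSol (S y) a)) (fwd? : Dec (toℕ a < toℕ (S y a))) →
                P (index (holeSlot (fsuc r') y a)) ≡ eval (holeStep r' y a (S y a) sol? fwd?) x →
                rwSol x (y , a)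
      by-step (yes sol) _ eq = sol , λ fg≡y → invalid $
        hole-valid-from r' y a (pigeonSlot (inject₁ r') g) eq (pigeon-before-next-hole r' g y a)
          (trans (next-pigeon-clause r' g) (cong (holeClause r') fg≡y))
        where g = x (gB y a)
      by-step (no ¬sol) (yes a<Sa) eq = ⊥-elim $ invalid $
        hole-valid-from r' y a (holeSlot (fsuc r') y (S y a)) eq (hole-before-hole (fsuc r') y a<Sa)
          (hole-clause r' y (S y a) (successor-solvedOrAdvancing (S y) a ¬sol a<Sa))
      by-step (no _) (no _) eq = ⊥-elim (invalid (valid-index (holeSlot (fsuc r') y a) (padding-ok eq)))

    correct : ∀ o → ¬ NodeValid F P o → rwSol x (kindSolution (kind o))
    correct o invalid with locate o
    ... | inTail T≤o                  = ⊥-elim (invalid (tail-valid T≤o))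
    ... | at (pigeonSlot r i)         = ⊥-elim (invalid (pigeon-valid r i))
    ... | at (holeSlot fzero y a)     =
      ⊥-elim (invalid (valid-index (holeSlot fzero y a) (padding-ok (P-index (holeSlot fzero y a)))))
    ... | at (holeSlot (fsuc r') y a) =
      subst (rwSol x) (cong kindSolution (sym (kind-index (holeSlot (fsuc r') y a)))) (hole-solution r' y a invalid)

  reduction : DTReduction (rwPHPPLS L M) (Refuter F sF) (3 + n)
  reduction = record
    { out       = λ o → kindTree (kind o)
    ; back      = λ o → leaf (kindSolution (kind o))
    ; correct   = Valid.correct
    ; outDepth  = λ x o → ≤-trans (length-deduplicate _≟R_ (queried (kindTree (kind o)) x))
                                  (length-kindTree (kind o) x)
    ; backDepth = λ _ _ → z≤n
    }

-- (n+1)(2L+1)M ≤ 2n · 3L · M = 6nLM, and 7m ≥ 7 leaves room for the final node.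
nodeCount-bound : ∀ {L M n m} → 1 ≤ L → 1 ≤ M → 1 ≤ n → 1 ≤ m → nodeCount L M n < 7 * (n * L * M + m)
nodeCount-bound {suc b} {suc M'} {suc a} {suc m'} _ _ _ _ =
  subst (suc (nodeCount (suc b) (suc M') (suc a)) ≤_) (sym (expand a b M' m')) (m≤m+n _ _)
  where
  expand : ∀ a b M' m' → 7 * (suc a * suc b * suc M' + suc m')
         ≡ suc (suc (suc a) * (2 * suc M' * suc b + suc M'))
           + (suc M' * (5 * a * b + 4 * a + 3 * b + 1) + 7 * m' + 6)
  expand = solve-∀

mainTheorem2 : ∃[ C ] (2 ≤ C × ∃[ D ] (∀ (L M n : ℕ) → 1 ≤ L → 1 ≤ M → 1 ≤ n →
                 ∀ {m} (F : CNF n m) → Unsatisfiable F →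
                 ∀ (sF : ℕ) → C * (n * L * M + m) ≤ sF → RequiresMoreThan F sF →
                 DTReduction (rwPHPPLS L M) (Refuter F sF) (D * n)))
mainTheorem2 = 7 , s≤s (s≤s z≤n) , 4 , reduction
  where
  reduction : ∀ (L M n : ℕ) → 1 ≤ L → 1 ≤ M → 1 ≤ n → ∀ {m} (F : CNF n m) → Unsatisfiable F →
              ∀ (sF : ℕ) → 7 * (n * L * M + m) ≤ sF → RequiresMoreThan F sF →
              DTReduction (rwPHPPLS L M) (Refuter F sF) (4 * n)
  reduction (suc L') (suc M') n 1≤L 1≤M 1≤n F unsat sF size _ =
    DTReduction-mono 3+n≤4n (Construction.reduction L' M' n F unsat sF room)
    where
    1≤m = ≤-<-trans z≤n (toℕ<n (proj₁ (unsat (λ _ → false))))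
    room = <-≤-trans (nodeCount-bound 1≤L 1≤M 1≤n 1≤m) size
    3+n≤4n = ≤-trans (+-monoˡ-≤ n (*-monoʳ-≤ 3 1≤n)) (≤-reflexive (+-comm (3 * n) n))
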